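{- Let $k,a,b$ be positive integers such that $k=a+b$. Then \[\binom{2k}{k}=\binom{2a}{a}\binom{1+2b}{b}\] if and only if $a=1$. -}

module Defs where

{-# OPTIONS --safe #-}
-- Put r i = 2(2i+1)/(i+1), so that C(2i+2,i+1) = r i · C(2i,i); since also
-- C(2i+2,i+1) = 2·C(2i+1,i), we get C(2b+1,b) = r 1 ⋯ r b, while
-- C(2(a+b),a+b) / C(2a,a) = r a ⋯ r (a+b-1). As r is strictly increasing, the two
-- products agree for a = 1 and the second is strictly larger once a ≥ 2 and b ≥ 1.
module Submission where

open import Defs
open import Data.Nat using (ℕ; _+_; _*_; _≤_)
open import Data.Nat.Combinatorics using (_C_)
open import Relation.Binary.PropositionalEquality using (_≡_)
open import Function.Bundles using (_⇔_)

open import Data.Nat using (zero; suc; _<_; _>_; z≤n; s≤s)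
open import Data.Nat.Properties
open import Data.Nat.Combinatorics
  using (nCk≡nC[n∸k]; nC1≡n; nCk+nC[k+1]≡[n+1]C[k+1])
open import Data.Nat.Tactic.RingSolver using (solve-∀)
open import Data.Empty using (⊥-elim)
open import Function.Bundles using (mk⇔)
open import Relation.Binary.PropositionalEquality
  using (refl; sym; trans; cong; cong₂; subst; module ≡-Reasoning)

k≤n⇒nCk>0 : ∀ {n k} → k ≤ n → n C k > 0
k≤n⇒nCk>0 {n}     {zero}  _         = s≤s z≤n
k≤n⇒nCk>0 {suc n} {suc k} (s≤s k≤n) =
  subst (_> 0) (nCk+nC[k+1]≡[n+1]C[k+1] n k)
        (≤-trans (k≤n⇒nCk>0 k≤n) (m≤m+n (n C k) (n C suc k)))

[k+1]*[n+1]C[k+1]≡[n+1]*nCk : ∀ n k → suc k * (suc n C suc k) ≡ suc n * (n C k)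
[k+1]*[n+1]C[k+1]≡[n+1]*nCk zero    zero    = refl
[k+1]*[n+1]C[k+1]≡[n+1]*nCk zero    (suc k) = *-zeroʳ (suc (suc k))
[k+1]*[n+1]C[k+1]≡[n+1]*nCk (suc n) zero    =
  trans (+-identityʳ (suc (suc n) C 1)) (trans (nC1≡n (suc (suc n))) (sym (*-identityʳ (suc (suc n)))))
[k+1]*[n+1]C[k+1]≡[n+1]*nCk (suc n) (suc k) = begin
  (2 + k) * (suc m C suc (suc k))        ≡⟨ cong ((2 + k) *_) (sym (nCk+nC[k+1]≡[n+1]C[k+1] m (suc k))) ⟩
  (2 + k) * (X + Y)                      ≡⟨ regroup k X Y ⟩
  X + ((1 + k) * X + (2 + k) * Y)        ≡⟨ cong (X +_) (cong₂ _+_ ([k+1]*[n+1]C[k+1]≡[n+1]*nCk n k)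
                                                                ([k+1]*[n+1]C[k+1]≡[n+1]*nCk n (suc k))) ⟩
  X + (m * (n C k) + m * (n C suc k))    ≡⟨ cong (X +_) (sym (*-distribˡ-+ m (n C k) (n C suc k))) ⟩
  X + m * (n C k + n C suc k)            ≡⟨ cong (λ Z → X + m * Z) (nCk+nC[k+1]≡[n+1]C[k+1] n k) ⟩
  X + m * X                              ∎
  where
  open ≡-Reasoning
  m = suc n
  X = m C suc k
  Y = m C suc (suc k)
  regroup : ∀ k x y → (2 + k) * (x + y) ≡ x + ((1 + k) * x + (2 + k) * y)
  regroup = solve-∀

central : ℕ → ℕ
central n = (2 * n) C n

oddCentral : ℕ → ℕ
oddCentral n = (1 + 2 * n) C n

central>0 : ∀ n → central n > 0
central>0 n = k≤n⇒nCk>0 (m≤m+n n (n + 0))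

oddCentral-sym : ∀ n → (1 + 2 * n) C suc n ≡ oddCentral n
oddCentral-sym n =
  trans (nCk≡nC[n∸k] (s≤s (m≤m+n n (n + 0))))
        (cong ((1 + 2 * n) C_) (trans (m+n∸m≡n n (n + 0)) (+-identityʳ n)))

central-suc : ∀ n → central (suc n) ≡ 2 * oddCentral n
central-suc n = begin
  (2 * suc n) C suc n                    ≡⟨ cong (_C suc n) (*-suc 2 n) ⟩
  (2 + 2 * n) C suc n                    ≡⟨ sym (nCk+nC[k+1]≡[n+1]C[k+1] (1 + 2 * n) n) ⟩
  oddCentral n + (1 + 2 * n) C suc n     ≡⟨ cong (oddCentral n +_) (oddCentral-sym n) ⟩
  oddCentral n + oddCentral n            ≡⟨ cong (oddCentral n +_) (sym (+-identityʳ (oddCentral n))) ⟩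
  2 * oddCentral n                       ∎
  where open ≡-Reasoning

[n+1]*oddCentral≡[2n+1]*central : ∀ n → suc n * oddCentral n ≡ (1 + 2 * n) * central n
[n+1]*oddCentral≡[2n+1]*central n =
  trans (cong (suc n *_) (sym (oddCentral-sym n))) ([k+1]*[n+1]C[k+1]≡[n+1]*nCk (2 * n) n)

central-rec : ∀ n → suc n * central (suc n) ≡ 2 * (1 + 2 * n) * central n
central-rec n = begin
  suc n * central (suc n)                ≡⟨ cong (suc n *_) (central-suc n) ⟩
  suc n * (2 * oddCentral n)             ≡⟨ x*[2*y]≡2*[x*y] (suc n) (oddCentral n) ⟩
  2 * (suc n * oddCentral n)             ≡⟨ cong (2 *_) ([n+1]*oddCentral≡[2n+1]*central n) ⟩
  2 * ((1 + 2 * n) * central n)          ≡⟨ sym (*-assoc 2 (1 + 2 * n) (central n)) ⟩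
  2 * (1 + 2 * n) * central n            ∎
  where
  open ≡-Reasoning
  x*[2*y]≡2*[x*y] : ∀ x y → x * (2 * y) ≡ 2 * (x * y)
  x*[2*y]≡2*[x*y] = solve-∀

oddCentral-rec : ∀ n → (2 + n) * oddCentral (suc n) ≡ 2 * (3 + 2 * n) * oddCentral n
oddCentral-rec n = begin
  (2 + n) * oddCentral (suc n)           ≡⟨ [n+1]*oddCentral≡[2n+1]*central (suc n) ⟩
  (1 + 2 * suc n) * central (suc n)      ≡⟨ cong ((1 + 2 * suc n) *_) (central-suc n) ⟩
  (1 + 2 * suc n) * (2 * oddCentral n)   ≡⟨ regroup n (oddCentral n) ⟩
  2 * (3 + 2 * n) * oddCentral n         ∎
  where
  open ≡-Reasoning
  regroup : ∀ n x → (1 + 2 * suc n) * (2 * x) ≡ 2 * (3 + 2 * n) * x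
  regroup = solve-∀

-- r (b + 1 + d) = r (b + 1) + 2d / ((b + 2)(b + 2 + d)), cross-multiplied.
ratio-increasing : ∀ d b →
  (2 + b) * (2 * (1 + 2 * (b + suc d))) ≡ suc (b + suc d) * (2 * (3 + 2 * b)) + 2 * d
ratio-increasing = solve-∀

-- The induction hypothesis multiplied by r (b + 1) ≤ r (b + 1 + d), denominators cleared;
-- the slack term is positive once d ≥ 1.
central*oddCentral-step : ∀ d b →
  central (suc d) * oddCentral b ≤ central (b + suc d) →
  (2 + b) * (suc b + suc d) * (central (suc d) * oddCentral (suc b)) + 2 * d * central (b + suc d)
    ≤ (2 + b) * (suc b + suc d) * central (suc b + suc d)
central*oddCentral-step d b IH = begin
  (2 + b) * m * (A * oddCentral (suc b)) + 2 * d * Y    ≡⟨ cong (_+ 2 * d * Y) regroup ⟩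
  c * (A * oddCentral b) + 2 * d * Y                    ≤⟨ +-monoˡ-≤ (2 * d * Y) (*-monoʳ-≤ c IH) ⟩
  c * Y + 2 * d * Y                                     ≡⟨ sym (*-distribʳ-+ Y c (2 * d)) ⟩
  (c + 2 * d) * Y                                       ≡⟨ cong (_* Y) (sym (ratio-increasing d b)) ⟩
  (2 + b) * (2 * (1 + 2 * n)) * Y                       ≡⟨ *-assoc (2 + b) (2 * (1 + 2 * n)) Y ⟩
  (2 + b) * (2 * (1 + 2 * n) * Y)                       ≡⟨ cong ((2 + b) *_) (sym (central-rec n)) ⟩
  (2 + b) * (m * central m)                             ≡⟨ sym (*-assoc (2 + b) m (central m)) ⟩
  (2 + b) * m * central m                               ∎
  where
  open ≤-Reasoning
  n = b + suc d
  m = suc n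
  A = central (suc d)
  Y = central n
  c = m * (2 * (3 + 2 * b))
  regroup : (2 + b) * m * (A * oddCentral (suc b)) ≡ c * (A * oddCentral b)
  regroup = begin-equality
    (2 + b) * m * (A * oddCentral (suc b))   ≡⟨ shuffle (2 + b) m A (oddCentral (suc b)) ⟩
    m * A * ((2 + b) * oddCentral (suc b))   ≡⟨ cong (m * A *_) (oddCentral-rec b) ⟩
    m * A * (2 * (3 + 2 * b) * oddCentral b) ≡⟨ [m*n]*[o*p]≡[m*o]*[n*p] m A (2 * (3 + 2 * b)) (oddCentral b) ⟩
    c * (A * oddCentral b)                   ∎
    where
    shuffle : ∀ x y z w → x * y * (z * w) ≡ y * z * (x * w)
    shuffle = solve-∀

central*oddCentral≤central : ∀ d b → central (suc d) * oddCentral b ≤ central (b + suc d)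
central*oddCentral≤central d zero    = ≤-reflexive (*-identityʳ (central (suc d)))
central*oddCentral≤central d (suc b) =
  *-cancelˡ-≤ ((2 + b) * (suc b + suc d))
    (≤-trans (m≤m+n _ (2 * d * central (b + suc d)))
             (central*oddCentral-step d b (central*oddCentral≤central d b)))

central*oddCentral<central : ∀ d b → central (2 + d) * oddCentral (suc b) < central (suc b + (2 + d))
central*oddCentral<central d b =
  *-cancelˡ-< ((2 + b) * (suc b + (2 + d))) _ _
    (<-≤-trans (m<m+n _ (≤-trans (central>0 (b + (2 + d))) (m≤m+n _ _)))
               (central*oddCentral-step (suc d) b (central*oddCentral≤central (suc d) b)))

central[a+b]≡central[a]*oddCentral[b]⇒a≡1 : ∀ a b → 1 ≤ a → 1 ≤ b →
  central (a + b) ≡ central a * oddCentral b → a ≡ 1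
central[a+b]≡central[a]*oddCentral[b]⇒a≡1 (suc zero)    _       _ _ _  = refl
central[a+b]≡central[a]*oddCentral[b]⇒a≡1 (suc (suc d)) (suc b) _ _ eq =
  ⊥-elim (<-irrefl (trans (sym eq) (cong central (+-comm (2 + d) (suc b))))
                   (central*oddCentral<central d b))

proposition2p10 : (k a b : ℕ) → 1 ≤ k → 1 ≤ a → 1 ≤ b → k ≡ a + b →
    (((2 * k) C k ≡ ((2 * a) C a) * ((1 + 2 * b) C b)) ⇔ (a ≡ 1))
proposition2p10 k a b _ 1≤a 1≤b refl =
  mk⇔ (central[a+b]≡central[a]*oddCentral[b]⇒a≡1 a b 1≤a 1≤b) λ { refl → central-suc b }
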